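{- Let $k\ge 3$ and let $v_i,v_j$ be two distinct inner vertices of $GP(2k,2)$ with $r=|i-j|\le k$. Then the number $\sigma(v_i,v_j)$ of geodesics between $v_i$ and $v_j$ is $$\sigma(v_i,v_j)=\begin{cases}1 & r\text{ even},\ r<k,\\ 2 & r\text{ even},\ r=k,\\ \frac{r+1}{2} & r\text{ odd},\ r<k,\\ r+1 & r\text{ odd},\ r=k.\end{cases}$$
   Context: For an integer $n\ge 5$, $GP(n,2)$ is the graph with vertex set $\{u_0,\dots,u_{n-1},v_0,\dots,v_{n-1}\}$ and edges $u_iu_{i+1}$ (outer edges), $u_iv_i$ (spokes) and $v_iv_{i+2}$ (inner edges) for $0\le i\le n-1$, subscripts modulo $n$. The $u_i$ are outer vertices, the $v_i$ inner vertices (for even $n$ they form two inner cycles, one of even-indexed and one of odd-indexed vertices). A geodesic is a shortest path; $\sigma(x,y)$ denotes the number of geodesics between $x$ and $y$. -}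

module Defs where

open import Data.Nat using (ℕ; zero; suc; _+_; _≤_)
open import Data.Fin using (Fin; toℕ)
open import Data.List using (List; []; _∷_; length)
open import Data.List.Relation.Unary.Unique.Propositional using (Unique)
open import Data.List.Membership.Propositional using (_∈_)
open import Data.Product using (Σ; _×_; ∃)
open import Data.Sum using (_⊎_)
open import Data.Empty using (⊥)
open import Relation.Binary.PropositionalEquality using (_≡_)

data V (n : ℕ) : Set where
  out : Fin n → V n
  inn : Fin n → V n

-- j ≡ i + s (mod n), for i j < n and s < n  (i + s ∈ [0, 2n) ).
Shift : ∀ {n} → ℕ → Fin n → Fin n → Set
Shift {n} s i j = (toℕ i + s ≡ toℕ j) ⊎ (toℕ i + s ≡ toℕ j + n)

Adj : ∀ {n} → V n → V n → Set
Adj (out i) (out j) = Shift 1 i j ⊎ Shift 1 j i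
Adj (out i) (inn j) = i ≡ j
Adj (inn i) (out j) = i ≡ j
Adj (inn i) (inn j) = Shift 2 i j ⊎ Shift 2 j i

data Walk {n : ℕ} : V n → V n → List (V n) → Set where
  here : ∀ {x} → Walk x x (x ∷ [])
  step : ∀ {x z y p} → Adj x z → Walk z y p → Walk x y (x ∷ p)

Path : ∀ {n} → V n → V n → List (V n) → Set
Path x y p = Walk x y p × Unique p

Geodesic : ∀ {n} → V n → V n → List (V n) → Set
Geodesic x y p = Path x y p × (∀ q → Path x y q → length p ≤ length q)

-- σ(x,y) = m : the set of geodesics between x and y has exactly m elements,
-- i.e. it is enumerated by a duplicate-free list of length m.
NumGeodesics : ∀ {n} → V n → V n → ℕ → Set
NumGeodesics {n} x y m =
  Σ (List (List (V n))) λ L →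
    Unique L × length L ≡ m ×
    (∀ p → Geodesic x y p → p ∈ L) × (∀ p → p ∈ L → Geodesic x y p)

-- Rotations of the index cycle and the reflection i ↦ n − 1 − i move any two inner vertices at index
-- distance r to v_r and v₀.  Let δ depend only on the cyclic distance c of an index from 0, with
-- δ(v_c) = c/2 or (c + 5)/2 and δ(u_c) = c/2 + 1 or (c + 3)/2 for c even or odd.  It vanishes at v₀ and
-- changes by at most one along each edge, so it bounds the distance to v₀ from below, and every walk
-- along which it drops by one at each step (a descent) is a geodesic; hence, once a vertex has a
-- descent, its geodesics to v₀ are exactly its descents.  These are counted by their first step: for
-- r < k the vertex v_r has the single descending neighbour v_{r−2} when r is even, and the two
-- descending neighbours v_{r−2} and u_r when r is odd, giving 1 and (r + 1)/2.  At r = k the reflection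
-- fixing v₀ and v_k contributes the mirror images, and for odd k the paths through u_k add two more.

module Submission where

open import Defs
open import Data.Nat using (ℕ; zero; suc; _+_; _*_; _∸_; _%_; _/_; _⊓_; _≤_; _<_; z≤n; s≤s; NonZero; >-nonZero; ∣_-_∣)
open import Data.Nat.Properties
open import Algebra.Properties.CommutativeSemigroup +-commutativeSemigroup using (xy∙z≈xz∙y)
open import Data.Nat.DivMod using (_mod_; m≡m%n+[m/n]*n; m*n/n≡m; m<n⇒m%n≡m; [m+n]%n≡m%n; %-distribˡ-+; m%n%n≡m%n; n%n≡0)
open import Data.Fin using (Fin; toℕ; opposite)
open import Data.Fin.Properties using (toℕ-fromℕ<; toℕ-injective; toℕ<n; opposite-prop; opposite-involutive)
open import Data.List using (List; []; _∷_; length; map; _++_)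
open import Data.List.Properties using (length-map; length-++; map-∘; map-cong; map-id; map-injective; ∷-injectiveʳ)
open import Data.List.Relation.Unary.Unique.Propositional using (Unique)
open import Data.List.Relation.Unary.Unique.Propositional.Properties using (map⁺; ++⁺)
open import Data.List.Relation.Unary.AllPairs using ([]; _∷_)
open import Data.List.Relation.Unary.All using (All; []; _∷_)
open import Data.List.Membership.Propositional using (_∈_)
open import Data.List.Membership.Propositional.Properties using (∈-map⁺; ∈-map⁻; ∈-++⁺ˡ; ∈-++⁺ʳ; ∈-++⁻)
open import Data.List.Relation.Unary.Any using (here; there)
open import Data.Product using (_×_; _,_; ∃)
open import Data.Sum using (_⊎_; inj₁; inj₂; [_,_]′)
import Data.Sum as Sum
open import Data.Empty using (⊥; ⊥-elim)
open import Relation.Binary.PropositionalEquality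
open import Relation.Nullary using (yes; no)
open import Relation.Binary.Definitions using (tri<; tri≈; tri>)
open import Data.Nat.Tactic.RingSolver using (solve-∀)

Enumerates : {A : Set} → (A → Set) → List A → Set
Enumerates P L = Unique L × (∀ p → P p → p ∈ L) × (∀ p → p ∈ L → P p)

enumerates-cong : {A : Set} {P Q : A → Set} {L : List A} →
  (∀ p → P p → Q p) → (∀ p → Q p → P p) → Enumerates P L → Enumerates Q L
enumerates-cong P⇒Q Q⇒P (u , complete , sound) =
  u , (λ p q → complete p (Q⇒P p q)) , (λ p p∈ → P⇒Q p (sound p p∈))

enumerates-⊎ : {A : Set} {P Q : A → Set} {L M : List A} → (∀ p → P p → Q p → ⊥) →
  Enumerates P L → Enumerates Q M → Enumerates (λ p → P p ⊎ Q p) (L ++ M)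
enumerates-⊎ {L = L} disjoint (uL , cL , sL) (uM , cM , sM) =
  ++⁺ uL uM (λ (p∈L , p∈M) → disjoint _ (sL _ p∈L) (sM _ p∈M)) ,
  (λ { p (inj₁ Pp) → ∈-++⁺ˡ (cL p Pp) ; p (inj₂ Qp) → ∈-++⁺ʳ L (cM p Qp) }) ,
  λ p p∈ → Sum.map (sL p) (sM p) (∈-++⁻ L p∈)

enumerates-∷ : {A : Set} {P : List A → Set} {L : List (List A)} (x : A) → Enumerates P L →
  Enumerates (λ p → ∃ λ q → p ≡ x ∷ q × P q) (map (x ∷_) L)
enumerates-∷ x (u , complete , sound) = map⁺ ∷-injectiveʳ u ,
  (λ { p (q , refl , Pq) → ∈-map⁺ (x ∷_) (complete q Pq) }) ,
  λ p p∈ → let (q , q∈ , p≡) = ∈-map⁻ (x ∷_) p∈ in q , p≡ , sound q q∈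

map-inverse : {A : Set} {f g : A → A} → (∀ x → g (f x) ≡ x) → ∀ xs → map g (map f xs) ≡ xs
map-inverse {f = f} {g} gf xs = trans (sym (map-∘ xs)) (trans (map-cong gf xs) (map-id xs))

module Automorphism {n : ℕ} (φ ψ : V n → V n)
    (ψφ : ∀ x → ψ (φ x) ≡ x) (φψ : ∀ x → φ (ψ x) ≡ x)
    (φ-adj : ∀ {x z} → Adj x z → Adj (φ x) (φ z)) (ψ-adj : ∀ {x z} → Adj x z → Adj (ψ x) (ψ z)) where

  φ-injective : ∀ {x y} → φ x ≡ φ y → x ≡ y
  φ-injective {x} {y} φx≡φy = trans (sym (ψφ x)) (trans (cong ψ φx≡φy) (ψφ y))

  ψ-injective : ∀ {x y} → ψ x ≡ ψ y → x ≡ y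
  ψ-injective {x} {y} ψx≡ψy = trans (sym (φψ x)) (trans (cong φ ψx≡ψy) (φψ y))

  map-path : (f : V n → V n) → (∀ {x y} → f x ≡ f y → x ≡ y) → (∀ {x z} → Adj x z → Adj (f x) (f z)) →
    ∀ {x y p} → Path x y p → Path (f x) (f y) (map f p)
  map-path f f-injective f-adj (w , u) = map-walk w , map⁺ f-injective u
    where
      map-walk : ∀ {x y p} → Walk x y p → Walk (f x) (f y) (map f p)
      map-walk here = here
      map-walk (step a w) = step (f-adj a) (map-walk w)

  path-ψ : ∀ {x y q} → Path (φ x) (φ y) q → Path x y (map ψ q)
  path-ψ {x} {y} {q} pq =
    subst₂ (λ a b → Path a b (map ψ q)) (ψφ x) (ψφ y) (map-path ψ ψ-injective ψ-adj pq)

  geodesic-φ : ∀ {x y p} → Geodesic x y p → Geodesic (φ x) (φ y) (map φ p)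
  geodesic-φ {p = p} (pp , shortest) = map-path φ φ-injective φ-adj pp , λ q pq →
    subst₂ _≤_ (sym (length-map φ p)) (length-map ψ q) (shortest (map ψ q) (path-ψ pq))

  geodesic-ψ : ∀ {x y q} → Geodesic (φ x) (φ y) q → Geodesic x y (map ψ q)
  geodesic-ψ {q = q} (pq , shortest) = path-ψ pq , λ r pr →
    subst₂ _≤_ (sym (length-map ψ q)) (length-map φ r) (shortest (map φ r) (map-path φ φ-injective φ-adj pr))

  numGeodesics-φ : ∀ {x y m} → NumGeodesics x y m → NumGeodesics (φ x) (φ y) m
  numGeodesics-φ (L , u , len , complete , sound) = map (map φ) L ,
    map⁺ (map-injective φ-injective) u ,
    trans (length-map (map φ) L) len ,
    (λ p g → subst (_∈ map (map φ) L) (map-inverse φψ p)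
               (∈-map⁺ (map φ) (complete (map ψ p) (geodesic-ψ g)))) ,
    λ p p∈ → let (q , q∈ , p≡) = ∈-map⁻ (map φ) p∈ in
      subst (Geodesic _ _) (sym p≡) (geodesic-φ (sound q q∈))

module Potential {n : ℕ} (h : V n → ℕ) (t : V n) (h-t : h t ≡ 0)
    (h-lip : ∀ {x z} → Adj x z → h x ≤ suc (h z)) where

  data Descent : V n → List (V n) → Set where
    stop : Descent t (t ∷ [])
    down : ∀ {x z p} → Adj x z → h x ≡ suc (h z) → Descent z p → Descent x (x ∷ p)

  walk-length : ∀ {x p} → Walk x t p → suc (h x) ≤ length p
  walk-length here = ≤-reflexive (cong suc h-t)
  walk-length (step a w) = ≤-trans (s≤s (h-lip a)) (s≤s (walk-length w))

  descent-length : ∀ {x p} → Descent x p → length p ≡ suc (h x)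
  descent-length stop = cong suc (sym h-t)
  descent-length (down a hx≡ d) = cong suc (trans (descent-length d) (sym hx≡))

  descent⇒walk : ∀ {x p} → Descent x p → Walk x t p
  descent⇒walk stop = here
  descent⇒walk (down a _ d) = step a (descent⇒walk d)

  descent-∈ : ∀ {x p w} → Descent x p → w ∈ p → h w ≤ h x
  descent-∈ stop (here refl) = ≤-refl
  descent-∈ (down _ _ _) (here refl) = ≤-refl
  descent-∈ (down _ hx≡ d) (there w∈) = ≤-trans (descent-∈ d w∈) (≤-trans (n≤1+n _) (≤-reflexive (sym hx≡)))

  descent⇒unique : ∀ {x p} → Descent x p → Unique p
  descent⇒unique stop = [] ∷ []
  descent⇒unique {x} (down {p = q} _ hx≡ d) =
    x∉ q (λ w∈ → subst (h _ <_) (sym hx≡) (s≤s (descent-∈ d w∈))) ∷ descent⇒unique d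
    where
      x∉ : ∀ r → (∀ {w} → w ∈ r → h w < h x) → All (x ≢_) r
      x∉ [] _ = []
      x∉ (w ∷ r) below = (λ { refl → <-irrefl refl (below (here refl)) }) ∷ x∉ r (λ w∈ → below (there w∈))

  walk⇒descent : ∀ {x p} → Walk x t p → length p ≡ suc (h x) → Descent x p
  walk⇒descent here _ = stop
  walk⇒descent {x} (step {z = z} {p = q} a w) |p|≡ = down a hx≡ (walk⇒descent w (trans |q|≡ hx≡))
    where
      |q|≡ : length q ≡ h x
      |q|≡ = suc-injective |p|≡
      hx≡ : h x ≡ suc (h z)
      hx≡ = ≤-antisym (h-lip a) (subst (suc (h z) ≤_) |q|≡ (walk-length w))

  descent⇒geodesic : ∀ {x p} → Descent x p → Geodesic x t p
  descent⇒geodesic d = (descent⇒walk d , descent⇒unique d) , λ q (w , _) →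
    subst (_≤ length q) (sym (descent-length d)) (walk-length w)

  geodesic⇒descent : ∀ {x p p₀} → Descent x p₀ → Geodesic x t p → Descent x p
  geodesic⇒descent d₀ ((w , _) , shortest) = walk⇒descent w (≤-antisym
    (≤-trans (shortest _ (descent⇒walk d₀ , descent⇒unique d₀)) (≤-reflexive (descent-length d₀)))
    (walk-length w))

  descents⇒numGeodesics : ∀ {x L c} → Enumerates (Descent x) L → length L ≡ suc c → NumGeodesics x t (suc c)
  descents⇒numGeodesics {L = p ∷ _} (u , complete , sound) |L|≡ = _ , u , |L|≡ ,
    (λ q g → complete q (geodesic⇒descent (sound p (here refl)) g)) , λ q q∈ → descent⇒geodesic (sound q q∈)

  descents-t : Enumerates (Descent t) ((t ∷ []) ∷ [])
  descents-t = [] ∷ [] ,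
    (λ { _ stop → here refl ; _ (down _ ht≡ _) → ⊥-elim (0≢1+n (trans (sym h-t) ht≡)) }) ,
    λ { _ (here refl) → stop }

  record Down (x z : V n) : Set where
    constructor _,_
    field
      edge : Adj x z
      drop : h x ≡ suc (h z)

  Via : V n → V n → List (V n) → Set
  Via x z p = ∃ λ q → p ≡ x ∷ q × Descent z q

  Via⇒descent : ∀ {x z p} → Down x z → Via x z p → Descent x p
  Via⇒descent (a , hx≡) (_ , refl , d) = down a hx≡ d

  descent⇒Via : ∀ {x p} → x ≢ t → Descent x p → ∃ λ z → Down x z × Via x z p
  descent⇒Via x≢t stop = ⊥-elim (x≢t refl)
  descent⇒Via _ (down {z = z} {p = q} a hx≡ d) = z , (a , hx≡) , q , refl , d

  Via-disjoint : ∀ {x z₁ z₂ p} → z₁ ≢ z₂ → Via x z₁ p → Via x z₂ p → ⊥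
  Via-disjoint z₁≢z₂ (q , refl , d₁) (_ , refl , d₂) = z₁≢z₂ (same-start d₁ d₂)
    where
      same-start : ∀ {z z′ q} → Descent z q → Descent z′ q → z ≡ z′
      same-start stop stop = refl
      same-start stop (down _ _ _) = refl
      same-start (down _ _ _) stop = refl
      same-start (down _ _ _) (down _ _ _) = refl

  Via-resp : ∀ {x z z′ p} → z ≡ z′ → Via x z p → Via x z′ p
  Via-resp refl v = v

  descents-via₁ : ∀ {x z₁ L₁} → x ≢ t → Down x z₁ → (∀ z → Down x z → z ≡ z₁) →
    Enumerates (Descent z₁) L₁ → Enumerates (Descent x) (map (x ∷_) L₁)
  descents-via₁ {x} x≢t s₁ only e₁ = enumerates-cong (λ _ → Via⇒descent s₁)
    (λ p d → let (z , s , v) = descent⇒Via x≢t d in Via-resp (only z s) v) (enumerates-∷ x e₁)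

  descents-via₂ : ∀ {x z₁ z₂ L₁ L₂} → x ≢ t → Down x z₁ → Down x z₂ → z₁ ≢ z₂ →
    (∀ z → Down x z → z ≡ z₁ ⊎ z ≡ z₂) →
    Enumerates (Descent z₁) L₁ → Enumerates (Descent z₂) L₂ →
    Enumerates (Descent x) (map (x ∷_) L₁ ++ map (x ∷_) L₂)
  descents-via₂ {x} x≢t s₁ s₂ z₁≢z₂ only e₁ e₂ =
    enumerates-cong (λ _ → [ Via⇒descent s₁ , Via⇒descent s₂ ]′)
      (λ p d → let (z , s , v) = descent⇒Via x≢t d in Sum.map (λ e → Via-resp e v) (λ e → Via-resp e v) (only z s))
      (enumerates-⊎ (λ _ → Via-disjoint z₁≢z₂) (enumerates-∷ x e₁) (enumerates-∷ x e₂))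

  descents-via₃ : ∀ {x z₁ z₂ z₃ L₁ L₂ L₃} → x ≢ t → Down x z₁ → Down x z₂ → Down x z₃ →
    z₁ ≢ z₂ → z₁ ≢ z₃ → z₂ ≢ z₃ → (∀ z → Down x z → z ≡ z₁ ⊎ z ≡ z₂ ⊎ z ≡ z₃) →
    Enumerates (Descent z₁) L₁ → Enumerates (Descent z₂) L₂ → Enumerates (Descent z₃) L₃ →
    Enumerates (Descent x) (map (x ∷_) L₁ ++ (map (x ∷_) L₂ ++ map (x ∷_) L₃))
  descents-via₃ {x} x≢t s₁ s₂ s₃ z₁≢z₂ z₁≢z₃ z₂≢z₃ only e₁ e₂ e₃ =
    enumerates-cong (λ _ → [ Via⇒descent s₁ , [ Via⇒descent s₂ , Via⇒descent s₃ ]′ ]′)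
      (λ p d → let (z , s , v) = descent⇒Via x≢t d in
        Sum.map (λ e → Via-resp e v) (Sum.map (λ e → Via-resp e v) (λ e → Via-resp e v)) (only z s))
      (enumerates-⊎ (λ _ v₁ → [ Via-disjoint z₁≢z₂ v₁ , Via-disjoint z₁≢z₃ v₁ ]′) (enumerates-∷ x e₁)
        (enumerates-⊎ (λ _ → Via-disjoint z₂≢z₃) (enumerates-∷ x e₂) (enumerates-∷ x e₃)))

  module Symmetry (ρ : V n → V n) (ρρ : ∀ x → ρ (ρ x) ≡ x) (ρ-adj : ∀ {x z} → Adj x z → Adj (ρ x) (ρ z))
      (h-ρ : ∀ x → h (ρ x) ≡ h x) (ρ-t : ρ t ≡ t) where

    Down-ρ : ∀ {x z} → Down x z → Down (ρ x) (ρ z)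
    Down-ρ {x} {z} (a , hx≡) = ρ-adj a , trans (h-ρ x) (trans hx≡ (cong suc (sym (h-ρ z))))

    descent-ρ : ∀ {x p} → Descent x p → Descent (ρ x) (map ρ p)
    descent-ρ stop = subst (λ w → Descent w (w ∷ [])) (sym ρ-t) stop
    descent-ρ (down a hx≡ d) = let (a′ , hx≡′) = Down-ρ (a , hx≡) in down a′ hx≡′ (descent-ρ d)

    descents-ρ : ∀ {x L} → Enumerates (Descent x) L → Enumerates (Descent (ρ x)) (map (map ρ) L)
    descents-ρ {x} {L} (u , complete , sound) = map⁺ (map-injective ρ-injective) u ,
      (λ p d → subst (_∈ map (map ρ) L) (map-inverse ρρ p)
        (∈-map⁺ (map ρ) (complete _ (subst (λ w → Descent w (map ρ p)) (ρρ x) (descent-ρ d))))) ,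
      λ p p∈ → let (q , q∈ , p≡) = ∈-map⁻ (map ρ) p∈ in
        subst (Descent (ρ x)) (sym p≡) (descent-ρ (sound q q∈))
      where
        ρ-injective : ∀ {x y} → ρ x ≡ ρ y → x ≡ y
        ρ-injective {x} {y} ρx≡ρy = trans (sym (ρρ x)) (trans (cong ρ ρx≡ρy) (ρρ y))

    descents-via-mirror : ∀ {x z L} → x ≢ t → ρ x ≡ x → Down x z → z ≢ ρ z →
      (∀ z′ → Down x z′ → z′ ≡ z ⊎ z′ ≡ ρ z) → Enumerates (Descent z) L →
      Enumerates (Descent x) (map (x ∷_) L ++ map (x ∷_) (map (map ρ) L))
    descents-via-mirror x≢t ρx≡x d z≢ρz only e =
      descents-via₂ x≢t d (subst (λ w → Down w _) ρx≡x (Down-ρ d)) z≢ρz only e (descents-ρ e)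

module Dihedral (n : ℕ) .{{_ : NonZero n}} (2≤n : 2 ≤ n) where

  mod-+ˡ : ∀ a b → (a % n + b) % n ≡ (a + b) % n
  mod-+ˡ a b = begin
    (a % n + b) % n           ≡⟨ %-distribˡ-+ (a % n) b n ⟩
    (a % n % n + b % n) % n   ≡⟨ cong (λ v → (v + b % n) % n) (m%n%n≡m%n a n) ⟩
    (a % n + b % n) % n       ≡⟨ %-distribˡ-+ a b n ⟨
    (a + b) % n               ∎
    where open ≡-Reasoning

  shift⇒% : ∀ {s} {i j : Fin n} → Shift s i j → (toℕ i + s) % n ≡ toℕ j
  shift⇒% {j = j} (inj₁ i+s≡j) = trans (cong (_% n) i+s≡j) (m<n⇒m%n≡m (toℕ<n j))
  shift⇒% {j = j} (inj₂ i+s≡j+n) =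
    trans (cong (_% n) i+s≡j+n) (trans ([m+n]%n≡m%n (toℕ j) n) (m<n⇒m%n≡m (toℕ<n j)))

  %⇒shift : ∀ {s} {i j : Fin n} → s ≤ n → (toℕ i + s) % n ≡ toℕ j → Shift s i j
  %⇒shift {s} {i} {j} s≤n i+s%n≡j with toℕ i + s <? n
  ... | yes i+s<n = inj₁ (trans (sym (m<n⇒m%n≡m i+s<n)) i+s%n≡j)
  ... | no i+s≮n = inj₂ (trans (sym (m∸n+n≡m n≤i+s)) (cong (_+ n) w≡j))
    where
      n≤i+s = ≮⇒≥ i+s≮n
      w = toℕ i + s ∸ n
      w<n : w < n
      w<n = subst (w <_) (m+n∸n≡m n n) (∸-monoˡ-< (+-mono-<-≤ (toℕ<n i) s≤n) n≤i+s)
      w≡j : w ≡ toℕ j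
      w≡j = trans (sym (m<n⇒m%n≡m w<n))
              (trans (sym ([m+n]%n≡m%n w n)) (trans (cong (_% n) (m∸n+n≡m n≤i+s)) i+s%n≡j))

  rotate : ℕ → Fin n → Fin n
  rotate c i = (toℕ i + c) mod n

  toℕ-rotate : ∀ c i → toℕ (rotate c i) ≡ (toℕ i + c) % n
  toℕ-rotate c i = toℕ-fromℕ< _

  rotate-shift : ∀ {s} c {i j : Fin n} → s ≤ n → Shift s i j → Shift s (rotate c i) (rotate c j)
  rotate-shift {s} c {i} {j} s≤n sh = %⇒shift s≤n (begin
    (toℕ (rotate c i) + s) % n  ≡⟨ cong (λ v → (v + s) % n) (toℕ-rotate c i) ⟩
    ((toℕ i + c) % n + s) % n   ≡⟨ mod-+ˡ (toℕ i + c) s ⟩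
    (toℕ i + c + s) % n         ≡⟨ cong (_% n) (xy∙z≈xz∙y (toℕ i) c s) ⟩
    (toℕ i + s + c) % n         ≡⟨ mod-+ˡ (toℕ i + s) c ⟨
    ((toℕ i + s) % n + c) % n   ≡⟨ cong (λ v → (v + c) % n) (shift⇒% {i = i} sh) ⟩
    (toℕ j + c) % n             ≡⟨ toℕ-rotate c j ⟨
    toℕ (rotate c j)            ∎)
    where open ≡-Reasoning

  rotate-inverse : ∀ c d → c + d ≡ n → ∀ i → rotate d (rotate c i) ≡ i
  rotate-inverse c d c+d≡n i = toℕ-injective (begin
    toℕ (rotate d (rotate c i))  ≡⟨ toℕ-rotate d (rotate c i) ⟩
    (toℕ (rotate c i) + d) % n   ≡⟨ cong (λ v → (v + d) % n) (toℕ-rotate c i) ⟩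
    ((toℕ i + c) % n + d) % n    ≡⟨ mod-+ˡ (toℕ i + c) d ⟩
    (toℕ i + c + d) % n          ≡⟨ cong (_% n) (trans (+-assoc (toℕ i) c d) (cong (toℕ i +_) c+d≡n)) ⟩
    (toℕ i + n) % n              ≡⟨ [m+n]%n≡m%n (toℕ i) n ⟩
    toℕ i % n                    ≡⟨ m<n⇒m%n≡m (toℕ<n i) ⟩
    toℕ i                        ∎)
    where open ≡-Reasoning

  opposite-+ : ∀ (i : Fin n) → toℕ (opposite i) + suc (toℕ i) ≡ n
  opposite-+ i = trans (cong (_+ suc (toℕ i)) (opposite-prop i)) (m∸n+n≡m (toℕ<n i))

  opposite-shift-+ : ∀ {s m} {i j : Fin n} →
    toℕ i + s ≡ toℕ j + m → toℕ (opposite j) + s ≡ toℕ (opposite i) + m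
  opposite-shift-+ {s} {m} {i} {j} i+s≡j+m = +-cancelʳ-≡ (suc (toℕ i)) _ _ (begin
    toℕ (opposite j) + s + suc (toℕ i)      ≡⟨ +-assoc (toℕ (opposite j)) s _ ⟩
    toℕ (opposite j) + (s + suc (toℕ i))    ≡⟨ cong (toℕ (opposite j) +_) (trans (+-suc s _) (cong suc (+-comm s _))) ⟩
    toℕ (opposite j) + suc (toℕ i + s)      ≡⟨ cong (λ v → toℕ (opposite j) + suc v) i+s≡j+m ⟩
    toℕ (opposite j) + suc (toℕ j + m)      ≡⟨ +-assoc (toℕ (opposite j)) (suc (toℕ j)) m ⟨
    toℕ (opposite j) + suc (toℕ j) + m      ≡⟨ cong (_+ m) (trans (opposite-+ j) (sym (opposite-+ i))) ⟩
    toℕ (opposite i) + suc (toℕ i) + m      ≡⟨ xy∙z≈xz∙y (toℕ (opposite i)) _ m ⟩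
    toℕ (opposite i) + m + suc (toℕ i)      ∎)
    where open ≡-Reasoning

  opposite-shift : ∀ {s} {i j : Fin n} → Shift s i j → Shift s (opposite j) (opposite i)
  opposite-shift (inj₁ i+s≡j) =
    inj₁ (trans (opposite-shift-+ (trans i+s≡j (sym (+-identityʳ _)))) (+-identityʳ _))
  opposite-shift (inj₂ i+s≡j+n) = inj₂ (opposite-shift-+ i+s≡j+n)

  mapV : (Fin n → Fin n) → V n → V n
  mapV f (out i) = out (f i)
  mapV f (inn i) = inn (f i)

  mapV-inverse : {f g : Fin n → Fin n} → (∀ i → g (f i) ≡ i) → ∀ x → mapV g (mapV f x) ≡ x
  mapV-inverse gf (out i) = cong out (gf i)
  mapV-inverse gf (inn i) = cong inn (gf i)

  PreservesShifts : (Fin n → Fin n) → Set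
  PreservesShifts f = ∀ {s} {i j : Fin n} → s ≤ 2 → Shift s i j → Shift s (f i) (f j) ⊎ Shift s (f j) (f i)

  mapV-adj : ∀ {f} → PreservesShifts f → ∀ {x z} → Adj x z → Adj (mapV f x) (mapV f z)
  mapV-adj pres {out i} {out j} (inj₁ sh) = pres (s≤s z≤n) sh
  mapV-adj pres {out i} {out j} (inj₂ sh) = Sum.swap (pres (s≤s z≤n) sh)
  mapV-adj {f} pres {out i} {inn j} i≡j = cong f i≡j
  mapV-adj {f} pres {inn i} {out j} i≡j = cong f i≡j
  mapV-adj pres {inn i} {inn j} (inj₁ sh) = pres ≤-refl sh
  mapV-adj pres {inn i} {inn j} (inj₂ sh) = Sum.swap (pres ≤-refl sh)

  rotate-preservesShifts : ∀ c → PreservesShifts (rotate c)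
  rotate-preservesShifts c s≤2 sh = inj₁ (rotate-shift c (≤-trans s≤2 2≤n) sh)

  opposite-preservesShifts : PreservesShifts opposite
  opposite-preservesShifts _ sh = inj₂ (opposite-shift sh)

  reflect : Fin n → Fin n
  reflect i = rotate 1 (opposite i)

  reflect-preservesShifts : PreservesShifts reflect
  reflect-preservesShifts s≤2 sh = inj₂ (rotate-shift 1 (≤-trans s≤2 2≤n) (opposite-shift sh))

  toℕ-reflect : ∀ i → toℕ (reflect i) ≡ (n ∸ toℕ i) % n
  toℕ-reflect i = trans (toℕ-rotate 1 (opposite i)) (cong (_% n) opposite+1≡n∸i)
    where
      opposite+1≡n∸i : toℕ (opposite i) + 1 ≡ n ∸ toℕ i
      opposite+1≡n∸i = sym (trans (cong (_∸ toℕ i) (sym (trans (+-assoc _ 1 (toℕ i)) (opposite-+ i))))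
                                  (m+n∸n≡m _ (toℕ i)))

  n∸[1+a]%n : ∀ {a} → a < n → (n ∸ suc a) % n ≡ n ∸ suc a
  n∸[1+a]%n a<n = m<n⇒m%n≡m (∸-monoʳ-< (s≤s z≤n) a<n)

  reflect-involutive : ∀ i → reflect (reflect i) ≡ i
  reflect-involutive i = toℕ-injective (trans (toℕ-reflect (reflect i))
    (trans (cong (λ v → (n ∸ v) % n) (toℕ-reflect i)) (involutive-ℕ (toℕ i) (toℕ<n i))))
    where
      involutive-ℕ : ∀ a → a < n → (n ∸ ((n ∸ a) % n)) % n ≡ a
      involutive-ℕ zero _ = trans (cong (λ v → (n ∸ v) % n) (n%n≡0 n)) (n%n≡0 n)
      involutive-ℕ (suc a) 1+a<n = trans (cong (λ v → (n ∸ v) % n) (n∸[1+a]%n (<⇒≤ 1+a<n)))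
        (trans (cong (_% n) (m∸[m∸n]≡n (<⇒≤ 1+a<n))) (m<n⇒m%n≡m 1+a<n))

  cdist : ℕ → ℕ
  cdist a = a ⊓ (n ∸ a)

  cdist-reflect : ∀ i → cdist (toℕ (reflect i)) ≡ cdist (toℕ i)
  cdist-reflect i = trans (cong cdist (toℕ-reflect i)) (cdist-ℕ (toℕ i) (toℕ<n i))
    where
      cdist-ℕ : ∀ a → a < n → cdist ((n ∸ a) % n) ≡ cdist a
      cdist-ℕ zero _ = cong cdist (n%n≡0 n)
      cdist-ℕ (suc a) 1+a<n = trans (cong cdist (n∸[1+a]%n (<⇒≤ 1+a<n)))
        (trans (cong ((n ∸ suc a) ⊓_) (m∸[m∸n]≡n (<⇒≤ 1+a<n))) (⊓-comm _ _))

module GP2k (k : ℕ) (k≥3 : 3 ≤ k) where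

  n : ℕ
  n = 2 * k

  n≡k+k : n ≡ k + k
  n≡k+k = cong (k +_) (+-identityʳ k)

  1≤k : 1 ≤ k
  1≤k = ≤-trans (s≤s z≤n) k≥3

  2≤k : 2 ≤ k
  2≤k = ≤-trans (n≤1+n 2) k≥3

  k<n : k < n
  k<n = subst (k <_) (sym n≡k+k) (m<m+n k 1≤k)

  ≤k⇒<n : ∀ {a} → a ≤ k → a < n
  ≤k⇒<n a≤k = ≤-<-trans a≤k k<n

  k+2<n : k + 2 < n
  k+2<n = subst (k + 2 <_) (sym n≡k+k) (+-monoʳ-< k k≥3)

  ≤k⇒+2<n : ∀ {a} → a ≤ k → a + 2 < n
  ≤k⇒+2<n a≤k = ≤-<-trans (+-monoˡ-≤ 2 a≤k) k+2<n

  0<n : 0 < n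
  0<n = ≤k⇒<n z≤n

  instance
    n-nonZero : NonZero n
    n-nonZero = >-nonZero 0<n

  open Dihedral n (≤-trans 2≤k (<⇒≤ k<n))

  I O : ℕ → V n
  I a = inn (a mod n)
  O a = out (a mod n)

  toℕ-mod : ∀ {a} → a < n → toℕ (a mod n) ≡ a
  toℕ-mod a<n = trans (toℕ-fromℕ< _) (m<n⇒m%n≡m a<n)

  ≡-mod : ∀ (j : Fin n) {b} → toℕ j ≡ b → j ≡ b mod n
  ≡-mod j refl = toℕ-injective (sym (toℕ-mod (toℕ<n j)))

  cdist-lo : ∀ {a} → a ≤ k → cdist a ≡ a
  cdist-lo {a} a≤k = m≤n⇒m⊓n≡m (begin
    a       ≤⟨ a≤k ⟩
    k       ≡⟨ m+n∸m≡n k k ⟨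
    k + k ∸ k ≡⟨ cong (_∸ k) n≡k+k ⟨
    n ∸ k   ≤⟨ ∸-monoʳ-≤ n a≤k ⟩
    n ∸ a   ∎)
    where open ≤-Reasoning

  complement-≤ : ∀ {a d} → a + d ≡ n → d ≤ k → k ≤ a
  complement-≤ {a} {d} a+d≡n d≤k =
    +-cancelʳ-≤ d k a (subst (k + d ≤_) (sym (trans a+d≡n n≡k+k)) (+-monoʳ-≤ k d≤k))

  complement-≥ : ∀ {a d} → a + d ≡ n → k ≤ a → d ≤ k
  complement-≥ {a} {d} a+d≡n k≤a =
    +-cancelˡ-≤ k d k (subst (k + d ≤_) (trans a+d≡n n≡k+k) (+-monoˡ-≤ d k≤a))

  cdist-hi : ∀ {a d} → a + d ≡ n → d ≤ k → cdist a ≡ d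
  cdist-hi {a} {d} a+d≡n d≤k = trans (cong (a ⊓_) (trans (cong (_∸ a) (sym a+d≡n)) (m+n∸m≡n a d)))
                                     (m≥n⇒m⊓n≡n (≤-trans d≤k (complement-≤ a+d≡n d≤k)))

  cdist-up : ∀ {a s b} → a + s ≡ b → b ≤ k → cdist b ≡ cdist a + s
  cdist-up {a} refl b≤k = trans (cdist-lo b≤k) (cong (_+ _) (sym (cdist-lo (≤-trans (m≤m+n a _) b≤k))))

  cdist-down : ∀ {a s b} → a + s ≡ b → b < n → k ≤ a → cdist a ≡ cdist b + s
  cdist-down {a} {s} {b} a+s≡b b<n k≤a =
    trans (cdist-hi a+[d+s]≡n d+s≤k) (cong (_+ s) (sym (cdist-hi b+d≡n d≤k)))
    where
      d = n ∸ b
      b+d≡n : b + d ≡ n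
      b+d≡n = m+[n∸m]≡n (<⇒≤ b<n)
      a+[d+s]≡n : a + (d + s) ≡ n
      a+[d+s]≡n = trans (cong (a +_) (+-comm d s)) (trans (sym (+-assoc a s d)) (trans (cong (_+ d) a+s≡b) b+d≡n))
      d+s≤k : d + s ≤ k
      d+s≤k = complement-≥ a+[d+s]≡n k≤a
      d≤k : d ≤ k
      d≤k = ≤-trans (m≤m+n d s) d+s≤k

  Near : ℕ → ℕ → ℕ → Set
  Near s c e = (e ≡ c + s) ⊎ (c ≡ e + s) ⊎ (c ≡ e)

  Near-sym : ∀ {s c e} → Near s c e → Near s e c
  Near-sym (inj₁ e≡c+s) = inj₂ (inj₁ e≡c+s)
  Near-sym (inj₂ (inj₁ c≡e+s)) = inj₁ c≡e+s
  Near-sym (inj₂ (inj₂ c≡e)) = inj₂ (inj₂ (sym c≡e))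

  wrap-≤ : ∀ {a s b} → s ≤ b → a + s ≡ b + n → a < n → ⊥
  wrap-≤ {a} {s} {b} s≤b a+s≡b+n a<n = <⇒≱ a<n (+-cancelʳ-≤ s n a
    (subst (n + s ≤_) (sym (trans a+s≡b+n (+-comm b n))) (+-monoʳ-≤ n s≤b)))

  straddle : ∀ {a} → a + 1 ≡ k → a + 2 + a ≡ n
  straddle {a} a+1≡k = trans (middle a) (trans (cong₂ _+_ a+1≡k a+1≡k) (sym n≡k+k))
    where
      middle : ∀ a → a + 2 + a ≡ a + 1 + (a + 1)
      middle = solve-∀

  cdist-shift₁ : ∀ {a b} → a < n → b < n → (a + 1 ≡ b) ⊎ (a + 1 ≡ b + n) → Near 1 (cdist a) (cdist b)
  cdist-shift₁ {a} {b} _ b<n (inj₁ a+1≡b) with a <? k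
  ... | yes a<k = inj₁ (cdist-up {a} a+1≡b (subst (_≤ k) (trans (+-comm 1 a) a+1≡b) a<k))
  ... | no a≮k = inj₂ (inj₁ (cdist-down {a} a+1≡b b<n (≮⇒≥ a≮k)))
  cdist-shift₁ {b = zero} _ _ (inj₂ a+1≡n) = inj₂ (inj₁ (cdist-hi a+1≡n 1≤k))
  cdist-shift₁ {a} {suc b} a<n _ (inj₂ a+1≡b+n) = ⊥-elim (wrap-≤ {a} {b = suc b} (s≤s z≤n) a+1≡b+n a<n)

  cdist-shift₂ : ∀ {a b} → a < n → b < n → (a + 2 ≡ b) ⊎ (a + 2 ≡ b + n) → Near 2 (cdist a) (cdist b)
  cdist-shift₂ {a} {b} _ b<n (inj₁ a+2≡b) with <-cmp (a + 1) k
  ... | tri< a+1<k _ _ = inj₁ (cdist-up {a} a+2≡b (subst (_≤ k) (trans (sym (+-suc a 1)) a+2≡b) a+1<k))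
  ... | tri≈ _ a+1≡k _ = inj₂ (inj₂ (trans (cdist-lo a≤k) (sym (cdist-hi b+a≡n a≤k))))
    where
      a≤k : a ≤ k
      a≤k = subst (a ≤_) a+1≡k (m≤m+n a 1)
      b+a≡n : b + a ≡ n
      b+a≡n = trans (cong (_+ a) (sym a+2≡b)) (straddle a+1≡k)
  ... | tri> _ _ k<a+1 = inj₂ (inj₁ (cdist-down {a} a+2≡b b<n (≤-pred (subst (suc k ≤_) (+-comm a 1) k<a+1))))
  cdist-shift₂ {b = zero} _ _ (inj₂ a+2≡n) = inj₂ (inj₁ (cdist-hi a+2≡n 2≤k))
  cdist-shift₂ {a} {suc zero} _ _ (inj₂ a+2≡1+n) =
    inj₂ (inj₂ (trans (cdist-hi a+1≡n 1≤k) (sym (cdist-lo 1≤k))))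
    where
      a+1≡n = suc-injective (trans (sym (+-suc a 1)) a+2≡1+n)
  cdist-shift₂ {a} {suc (suc b)} a<n _ (inj₂ a+2≡b+n) =
    ⊥-elim (wrap-≤ {a} {b = suc (suc b)} (s≤s (s≤s z≤n)) a+2≡b+n a<n)

  -- The distances from v₀ to v_c and to u_c for c ≤ k; v_c with c odd is reached through u₀ u₁ v₁.
  δᵢ δₒ : ℕ → ℕ
  δᵢ zero = 0
  δᵢ (suc zero) = 3
  δᵢ (suc (suc c)) = suc (δᵢ c)
  δₒ zero = 1
  δₒ (suc zero) = 2
  δₒ (suc (suc c)) = suc (δₒ c)

  δ : V n → ℕ
  δ (inn i) = δᵢ (cdist (toℕ i))
  δ (out i) = δₒ (cdist (toℕ i))

  δᵢ-+2 : ∀ c → δᵢ (c + 2) ≡ suc (δᵢ c)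
  δᵢ-+2 c = cong δᵢ (+-comm c 2)

  δₒ-mono : ∀ c → δₒ c ≤ δₒ (suc c)
  δₒ-mono zero = s≤s z≤n
  δₒ-mono (suc zero) = ≤-refl
  δₒ-mono (suc (suc c)) = s≤s (δₒ-mono c)

  δₒ-step : ∀ c → δₒ (suc c) ≤ suc (δₒ c)
  δₒ-step zero = ≤-refl
  δₒ-step (suc zero) = s≤s (s≤s z≤n)
  δₒ-step (suc (suc c)) = s≤s (δₒ-step c)

  δᵢ-near : ∀ {c e} → Near 2 c e → δᵢ c ≤ suc (δᵢ e)
  δᵢ-near {c} (inj₁ refl) = subst (δᵢ c ≤_) (cong suc (sym (δᵢ-+2 c))) (m≤n+m (δᵢ c) 2)
  δᵢ-near {e = e} (inj₂ (inj₁ refl)) = ≤-reflexive (δᵢ-+2 e)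
  δᵢ-near (inj₂ (inj₂ refl)) = n≤1+n _

  δₒ-near : ∀ {c e} → Near 1 c e → δₒ c ≤ suc (δₒ e)
  δₒ-near {c} (inj₁ refl) = ≤-trans (δₒ-mono c) (≤-trans (≤-reflexive (cong δₒ (+-comm 1 c))) (n≤1+n _))
  δₒ-near {e = e} (inj₂ (inj₁ refl)) = subst (λ v → δₒ v ≤ suc (δₒ e)) (+-comm 1 e) (δₒ-step e)
  δₒ-near (inj₂ (inj₂ refl)) = n≤1+n _

  δₒ≤1+δᵢ : ∀ c → δₒ c ≤ suc (δᵢ c)
  δₒ≤1+δᵢ zero = ≤-refl
  δₒ≤1+δᵢ (suc zero) = s≤s (s≤s z≤n)
  δₒ≤1+δᵢ (suc (suc c)) = s≤s (δₒ≤1+δᵢ c)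

  δᵢ≤1+δₒ : ∀ c → δᵢ c ≤ suc (δₒ c)
  δᵢ≤1+δₒ zero = z≤n
  δᵢ≤1+δₒ (suc zero) = ≤-refl
  δᵢ≤1+δₒ (suc (suc c)) = s≤s (δᵢ≤1+δₒ c)

  δ-lip : ∀ {x z} → Adj x z → δ x ≤ suc (δ z)
  δ-lip {out i} {out j} (inj₁ sh) = δₒ-near (cdist-shift₁ (toℕ<n i) (toℕ<n j) sh)
  δ-lip {out i} {out j} (inj₂ sh) = δₒ-near (Near-sym (cdist-shift₁ (toℕ<n j) (toℕ<n i) sh))
  δ-lip {out i} {inn .i} refl = δₒ≤1+δᵢ _
  δ-lip {inn i} {out .i} refl = δᵢ≤1+δₒ _
  δ-lip {inn i} {inn j} (inj₁ sh) = δᵢ-near (cdist-shift₂ (toℕ<n i) (toℕ<n j) sh)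
  δ-lip {inn i} {inn j} (inj₂ sh) = δᵢ-near (Near-sym (cdist-shift₂ (toℕ<n j) (toℕ<n i) sh))

  t : V n
  t = I 0

  δ-t : δ t ≡ 0
  δ-t = cong δᵢ (trans (cong cdist (toℕ-mod 0<n)) (cdist-lo z≤n))

  open Potential δ t δ-t δ-lip

  ρ : V n → V n
  ρ = mapV reflect

  reflect-mod : ∀ {b c} → b < n → b + c ≡ n → reflect (b mod n) ≡ c mod n
  reflect-mod {b} {c} b<n b+c≡n = toℕ-injective (begin
    toℕ (reflect (b mod n))      ≡⟨ toℕ-reflect (b mod n) ⟩
    (n ∸ toℕ (b mod n)) % n      ≡⟨ cong (λ v → (n ∸ v) % n) (toℕ-mod b<n) ⟩
    (n ∸ b) % n                  ≡⟨ cong (λ v → (v ∸ b) % n) (sym b+c≡n) ⟩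
    (b + c ∸ b) % n              ≡⟨ cong (_% n) (m+n∸m≡n b c) ⟩
    c % n                        ≡⟨ toℕ-fromℕ< _ ⟨
    toℕ (c mod n)                ∎)
    where open ≡-Reasoning

  ρ-I : ∀ {b c} → b < n → b + c ≡ n → ρ (I b) ≡ I c
  ρ-I b<n b+c≡n = cong inn (reflect-mod b<n b+c≡n)

  ρ-O : ∀ {b c} → b < n → b + c ≡ n → ρ (O b) ≡ O c
  ρ-O b<n b+c≡n = cong out (reflect-mod b<n b+c≡n)

  ρ-t : ρ t ≡ t
  ρ-t = trans (ρ-I 0<n refl)
    (cong inn (toℕ-injective (trans (toℕ-fromℕ< _) (trans (n%n≡0 n) (sym (toℕ-mod 0<n))))))

  δ-ρ : ∀ x → δ (ρ x) ≡ δ x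
  δ-ρ (out i) = cong δₒ (cdist-reflect i)
  δ-ρ (inn i) = cong δᵢ (cdist-reflect i)

  open Symmetry ρ (mapV-inverse reflect-involutive) (mapV-adj reflect-preservesShifts) δ-ρ ρ-t

  double : ℕ → ℕ
  double zero = zero
  double (suc m) = suc (suc (double m))

  double≡*2 : ∀ m → double m ≡ m * 2
  double≡*2 zero = refl
  double≡*2 (suc m) = cong (λ v → suc (suc v)) (double≡*2 m)

  δᵢ-double : ∀ m → δᵢ (double m) ≡ m
  δᵢ-double zero = refl
  δᵢ-double (suc m) = cong suc (δᵢ-double m)

  δᵢ-double+1 : ∀ m → δᵢ (suc (double m)) ≡ 3 + m
  δᵢ-double+1 zero = refl
  δᵢ-double+1 (suc m) = cong suc (δᵢ-double+1 m)

  δₒ-double : ∀ m → δₒ (double m) ≡ 1 + m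
  δₒ-double zero = refl
  δₒ-double (suc m) = cong suc (δₒ-double m)

  δₒ-double+1 : ∀ m → δₒ (suc (double m)) ≡ 2 + m
  δₒ-double+1 zero = refl
  δₒ-double+1 (suc m) = cong suc (δₒ-double+1 m)

  δ-I-lo : ∀ {b} → b ≤ k → δ (I b) ≡ δᵢ b
  δ-I-lo b≤k = cong δᵢ (trans (cong cdist (toℕ-mod (≤k⇒<n b≤k))) (cdist-lo b≤k))

  δ-O-lo : ∀ {b} → b ≤ k → δ (O b) ≡ δₒ b
  δ-O-lo b≤k = cong δₒ (trans (cong cdist (toℕ-mod (≤k⇒<n b≤k))) (cdist-lo b≤k))

  δ-I-hi : ∀ {b d} → b + d ≡ n → d ≤ k → 0 < d → δ (I b) ≡ δᵢ d
  δ-I-hi {b} b+d≡n d≤k 0<d =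
    cong δᵢ (trans (cong cdist (toℕ-mod (subst (b <_) b+d≡n (m<m+n b 0<d)))) (cdist-hi b+d≡n d≤k))

  δ-O-hi : ∀ {b d} → b + d ≡ n → d ≤ k → 0 < d → δ (O b) ≡ δₒ d
  δ-O-hi {b} b+d≡n d≤k 0<d =
    cong δₒ (trans (cong cdist (toℕ-mod (subst (b <_) b+d≡n (m<m+n b 0<d)))) (cdist-hi b+d≡n d≤k))

  δ-I-double : ∀ m → double m ≤ k → δ (I (double m)) ≡ m
  δ-I-double m a≤k = trans (δ-I-lo a≤k) (δᵢ-double m)

  δ-I-double+1 : ∀ m → suc (double m) ≤ k → δ (I (suc (double m))) ≡ 3 + m
  δ-I-double+1 m a≤k = trans (δ-I-lo a≤k) (δᵢ-double+1 m)

  δ-O-double : ∀ m → double m ≤ k → δ (O (double m)) ≡ 1 + m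
  δ-O-double m a≤k = trans (δ-O-lo a≤k) (δₒ-double m)

  δ-O-double+1 : ∀ m → suc (double m) ≤ k → δ (O (suc (double m))) ≡ 2 + m
  δ-O-double+1 m a≤k = trans (δ-O-lo a≤k) (δₒ-double+1 m)

  δ-O-+1 : ∀ {a} → a < k → δ (O (a + 1)) ≡ δₒ (suc a)
  δ-O-+1 {a} a<k = trans (δ-O-lo (subst (_≤ k) (+-comm 1 a) a<k)) (cong δₒ (+-comm a 1))

  δ-I≤δ-I+2 : ∀ {a} → a < k → δ (I a) ≤ δ (I (a + 2))
  δ-I≤δ-I+2 {a} a<k with m≤n⇒m<n∨m≡n (subst (_≤ k) (+-comm 1 a) a<k)
  ... | inj₁ a+1<k =
    ≤-trans (n≤1+n _) (≤-reflexive (sym (trans (δ-I-lo a+2≤k) (trans (δᵢ-+2 a) (cong suc (sym (δ-I-lo (<⇒≤ a<k))))))))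
    where
      a+2≤k : a + 2 ≤ k
      a+2≤k = subst (_≤ k) (sym (+-suc a 1)) a+1<k
  ... | inj₂ a+1≡k = ≤-reflexive (trans (δ-I-lo (<⇒≤ a<k))
    (sym (cong δᵢ (trans (cong cdist (toℕ-mod (≤k⇒+2<n (<⇒≤ a<k)))) (cdist-hi (straddle a+1≡k) (<⇒≤ a<k))))))

  Down-intro : ∀ {x z v} → Adj x z → δ x ≡ suc v → δ z ≡ v → Down x z
  Down-intro a δx≡1+v δz≡v = a , trans δx≡1+v (cong suc (sym δz≡v))

  Down-absurd : ∀ {x z u v} → δ x ≡ u → δ z ≡ v → u ≤ v → Down x z → ⊥
  Down-absurd refl refl δx≤δz (_ , δx≡1+δz) = 1+n≰n (subst (_≤ _) δx≡1+δz δx≤δz)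

  shift-neighbour : ∀ {s a} {j : Fin n} → a + s < n → Shift s (a mod n) j ⊎ Shift s j (a mod n) →
    toℕ j ≡ a + s ⊎ toℕ j + s ≡ a ⊎ toℕ j + s ≡ a + n
  shift-neighbour {s} {a} {j} a+s<n adj with toℕ-mod (≤-<-trans (m≤m+n a s) a+s<n) | adj
  ... | a≡ | inj₁ (inj₁ a+s≡j) = inj₁ (trans (sym a+s≡j) (cong (_+ s) a≡))
  ... | a≡ | inj₁ (inj₂ a+s≡j+n) =
    ⊥-elim (<⇒≱ a+s<n (subst (n ≤_) (trans (sym a+s≡j+n) (cong (_+ s) a≡)) (m≤n+m n (toℕ j))))
  ... | a≡ | inj₂ (inj₁ j+s≡a) = inj₂ (inj₁ (trans j+s≡a a≡))
  ... | a≡ | inj₂ (inj₂ j+s≡a+n) = inj₂ (inj₂ (trans j+s≡a+n (cong (_+ n) a≡)))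

  ∸-≡ : ∀ {x s a} → x + s ≡ a → x ≡ a ∸ s
  ∸-≡ {x} {s} refl = sym (m+n∸n≡m x s)

  neighbours-I : ∀ {a z} → 2 ≤ a → a ≤ k → Adj (I a) z → z ≡ O a ⊎ z ≡ I (a + 2) ⊎ z ≡ I (a ∸ 2)
  neighbours-I {z = out j} _ _ a≡j = inj₁ (cong out (sym a≡j))
  neighbours-I {a} {inn j} 2≤a a≤k adj with shift-neighbour (≤k⇒+2<n a≤k) adj
  ... | inj₁ j≡a+2 = inj₂ (inj₁ (cong inn (≡-mod j j≡a+2)))
  ... | inj₂ (inj₁ j+2≡a) = inj₂ (inj₂ (cong inn (≡-mod j (∸-≡ j+2≡a))))
  ... | inj₂ (inj₂ j+2≡a+n) = ⊥-elim (wrap-≤ 2≤a j+2≡a+n (toℕ<n j))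

  neighbours-O : ∀ {a z} → 1 ≤ a → a ≤ k → Adj (O a) z → z ≡ I a ⊎ z ≡ O (a + 1) ⊎ z ≡ O (a ∸ 1)
  neighbours-O {z = inn j} _ _ a≡j = inj₁ (cong inn (sym a≡j))
  neighbours-O {a} {out j} 1≤a a≤k adj with shift-neighbour (≤-<-trans (+-monoʳ-≤ a (n≤1+n 1)) (≤k⇒+2<n a≤k)) adj
  ... | inj₁ j≡a+1 = inj₂ (inj₁ (cong out (≡-mod j j≡a+1)))
  ... | inj₂ (inj₁ j+1≡a) = inj₂ (inj₂ (cong out (≡-mod j (∸-≡ j+1≡a))))
  ... | inj₂ (inj₂ j+1≡a+n) = ⊥-elim (wrap-≤ 1≤a j+1≡a+n (toℕ<n j))

  neighbours-I1 : ∀ {z} → Adj (I 1) z → z ≡ O 1 ⊎ z ≡ I 3 ⊎ ∃ λ b → b + 1 ≡ n × z ≡ I b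
  neighbours-I1 {out j} 1≡j = inj₁ (cong out (sym 1≡j))
  neighbours-I1 {inn j} adj with shift-neighbour (≤k⇒+2<n 1≤k) adj
  ... | inj₁ j≡3 = inj₂ (inj₁ (cong inn (≡-mod j j≡3)))
  ... | inj₂ (inj₁ j+2≡1) = ⊥-elim (1+n≢0 (suc-injective (trans (+-comm 2 (toℕ j)) j+2≡1)))
  ... | inj₂ (inj₂ j+2≡1+n) =
    inj₂ (inj₂ (toℕ j , suc-injective (trans (sym (+-suc (toℕ j) 1)) j+2≡1+n) , cong inn (≡-mod j refl)))

  neighbours-O0 : ∀ {z} → Adj (O 0) z → z ≡ I 0 ⊎ z ≡ O 1 ⊎ ∃ λ b → b + 1 ≡ n × z ≡ O b
  neighbours-O0 {inn j} 0≡j = inj₁ (cong inn (sym 0≡j))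
  neighbours-O0 {out j} adj with shift-neighbour (≤-<-trans (s≤s z≤n) (≤k⇒+2<n z≤n)) adj
  ... | inj₁ j≡1 = inj₂ (inj₁ (cong out (≡-mod j j≡1)))
  ... | inj₂ (inj₁ j+1≡0) = ⊥-elim (1+n≢0 (trans (+-comm 1 (toℕ j)) j+1≡0))
  ... | inj₂ (inj₂ j+1≡n) = inj₂ (inj₂ (toℕ j , j+1≡n , cong out (≡-mod j refl)))

  mod-injective : ∀ {a b} → a < n → b < n → a mod n ≡ b mod n → a ≡ b
  mod-injective a<n b<n a≡b = trans (sym (toℕ-mod a<n)) (trans (cong toℕ a≡b) (toℕ-mod b<n))

  index : V n → Fin n
  index (out i) = i
  index (inn i) = i

  I-≢ : ∀ {a b} → a < n → b < n → a ≢ b → I a ≢ I b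
  I-≢ a<n b<n a≢b Ia≡Ib = a≢b (mod-injective a<n b<n (cong index Ia≡Ib))

  O-≢ : ∀ {a b} → a < n → b < n → a ≢ b → O a ≢ O b
  O-≢ a<n b<n a≢b Oa≡Ob = a≢b (mod-injective a<n b<n (cong index Oa≡Ob))

  I-adj-I : ∀ {a b} → a < n → b < n → b + 2 ≡ a → Adj (I a) (I b)
  I-adj-I a<n b<n b+2≡a = inj₂ (inj₁ (trans (cong (_+ 2) (toℕ-mod b<n)) (trans b+2≡a (sym (toℕ-mod a<n)))))

  O-adj-O : ∀ {a b} → a < n → b < n → b + 1 ≡ a → Adj (O a) (O b)
  O-adj-O a<n b<n b+1≡a = inj₂ (inj₁ (trans (cong (_+ 1) (toℕ-mod b<n)) (trans b+1≡a (sym (toℕ-mod a<n)))))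

  evenPath : ℕ → List (V n)
  evenPath zero = t ∷ []
  evenPath (suc m) = I (double (suc m)) ∷ evenPath m

  descents-I-even : ∀ m → double m < k → Enumerates (Descent (I (double m))) (evenPath m ∷ [])
  descents-I-even zero _ = descents-t
  descents-I-even (suc m) a<k = descents-via₁ (I-≢ (≤k⇒<n a≤k) 0<n (λ ())) down₁ only (descents-I-even m b<k)
    where
      a≤k = <⇒≤ a<k
      b<k : double m < k
      b<k = <-trans (n<1+n _) (<-trans (n<1+n _) a<k)
      δx = δ-I-double (suc m) a≤k
      down₁ : Down (I (double (suc m))) (I (double m))
      down₁ = Down-intro (I-adj-I (≤k⇒<n a≤k) (≤k⇒<n (<⇒≤ b<k)) (+-comm (double m) 2)) δx (δ-I-double m (<⇒≤ b<k))
      only : ∀ z → Down (I (double (suc m))) z → z ≡ I (double m)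
      only z d with neighbours-I (s≤s (s≤s z≤n)) a≤k (Down.edge d)
      ... | inj₁ refl = ⊥-elim (Down-absurd δx (δ-O-double (suc m) a≤k) (n≤1+n _) d)
      ... | inj₂ (inj₁ refl) = ⊥-elim (Down-absurd refl refl (δ-I≤δ-I+2 a<k) d)
      ... | inj₂ (inj₂ refl) = refl

  descents-O-even : ∀ m → double m < k → Enumerates (Descent (O (double m))) ((O (double m) ∷ evenPath m) ∷ [])
  descents-O-even zero 0<k = descents-via₁ (λ ()) down₁ only (descents-I-even 0 0<k)
    where
      down₁ : Down (O 0) (I 0)
      down₁ = Down-intro refl (δ-O-lo z≤n) (δ-I-lo z≤n)
      only : ∀ z → Down (O 0) z → z ≡ I 0
      only z d with neighbours-O0 (Down.edge d)
      ... | inj₁ refl = refl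
      ... | inj₂ (inj₁ refl) = ⊥-elim (Down-absurd (δ-O-lo z≤n) (δ-O-lo 1≤k) (s≤s z≤n) d)
      ... | inj₂ (inj₂ (_ , b+1≡n , refl)) = ⊥-elim (Down-absurd (δ-O-lo z≤n) (δ-O-hi b+1≡n 1≤k (s≤s z≤n)) (s≤s z≤n) d)
  descents-O-even (suc m) a<k = descents-via₁ (λ ()) down₁ only (descents-I-even (suc m) a<k)
    where
      a≤k = <⇒≤ a<k
      δx = δ-O-double (suc m) a≤k
      down₁ : Down (O (double (suc m))) (I (double (suc m)))
      down₁ = Down-intro refl δx (δ-I-double (suc m) a≤k)
      only : ∀ z → Down (O (double (suc m))) z → z ≡ I (double (suc m))
      only z d with neighbours-O (s≤s z≤n) a≤k (Down.edge d)
      ... | inj₁ refl = refl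
      ... | inj₂ (inj₁ refl) = ⊥-elim (Down-absurd δx (trans (δ-O-+1 a<k) (δₒ-double+1 (suc m))) (n≤1+n _) d)
      ... | inj₂ (inj₂ refl) = ⊥-elim (Down-absurd δx (δ-O-double+1 m (≤-trans (n≤1+n _) a≤k)) ≤-refl d)

  descents-O-odd : ∀ m → suc (double m) < k →
    Enumerates (Descent (O (suc (double m)))) ((O (suc (double m)) ∷ O (double m) ∷ evenPath m) ∷ [])
  descents-O-odd m a<k = descents-via₁ (λ ()) down₁ only (descents-O-even m b<k)
    where
      a≤k = <⇒≤ a<k
      b<k = <-trans (n<1+n _) a<k
      δx = δ-O-double+1 m a≤k
      down₁ : Down (O (suc (double m))) (O (double m))
      down₁ = Down-intro (O-adj-O (≤k⇒<n a≤k) (≤k⇒<n (<⇒≤ b<k)) (+-comm (double m) 1)) δx (δ-O-double m (<⇒≤ b<k))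
      only : ∀ z → Down (O (suc (double m))) z → z ≡ O (double m)
      only z d with neighbours-O (s≤s z≤n) a≤k (Down.edge d)
      ... | inj₁ refl = ⊥-elim (Down-absurd δx (δ-I-double+1 m a≤k) (n≤1+n _) d)
      ... | inj₂ (inj₁ refl) = ⊥-elim (Down-absurd δx (trans (δ-O-+1 a<k) (δₒ-double (suc m))) ≤-refl d)
      ... | inj₂ (inj₂ refl) = refl

  oddPaths : ℕ → List (List (V n))
  oddPaths zero = (I 1 ∷ O 1 ∷ O 0 ∷ evenPath 0) ∷ []
  oddPaths (suc m) = map (I a ∷_) (oddPaths m) ++ (I a ∷ O a ∷ O (double (suc m)) ∷ evenPath (suc m)) ∷ []
    where a = suc (double (suc m))

  length-oddPaths : ∀ m → length (oddPaths m) ≡ suc m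
  length-oddPaths zero = refl
  length-oddPaths (suc m) = trans (length-++ (map _ (oddPaths m)))
    (trans (cong (_+ 1) (trans (length-map _ (oddPaths m)) (length-oddPaths m))) (+-comm (suc m) 1))

  descents-I-odd : ∀ m → suc (double m) < k → Enumerates (Descent (I (suc (double m)))) (oddPaths m)
  descents-I-odd zero 1<k = descents-via₁ (I-≢ (≤k⇒<n 1≤k) 0<n (λ ())) down₁ only (descents-O-odd 0 1<k)
    where
      δx = δ-I-lo 1≤k
      down₁ : Down (I 1) (O 1)
      down₁ = Down-intro refl δx (δ-O-lo 1≤k)
      only : ∀ z → Down (I 1) z → z ≡ O 1
      only z d with neighbours-I1 (Down.edge d)
      ... | inj₁ refl = refl
      ... | inj₂ (inj₁ refl) = ⊥-elim (Down-absurd δx (δ-I-lo k≥3) (n≤1+n _) d)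
      ... | inj₂ (inj₂ (_ , b+1≡n , refl)) = ⊥-elim (Down-absurd δx (δ-I-hi b+1≡n 1≤k (s≤s z≤n)) ≤-refl d)
  descents-I-odd (suc m) a<k = descents-via₂ (I-≢ (≤k⇒<n a≤k) 0<n (λ ())) down₁ down₂ (λ ()) only
    (descents-I-odd m b<k) (descents-O-odd (suc m) a<k)
    where
      a = suc (double (suc m))
      a≤k = <⇒≤ a<k
      b<k : suc (double m) < k
      b<k = <-trans (n<1+n _) (<-trans (n<1+n _) a<k)
      δx = δ-I-double+1 (suc m) a≤k
      down₁ : Down (I a) (I (suc (double m)))
      down₁ = Down-intro (I-adj-I (≤k⇒<n a≤k) (≤k⇒<n (<⇒≤ b<k)) (+-comm (suc (double m)) 2)) δx
                         (δ-I-double+1 m (<⇒≤ b<k))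
      down₂ : Down (I a) (O a)
      down₂ = Down-intro refl δx (δ-O-double+1 (suc m) a≤k)
      only : ∀ z → Down (I a) z → z ≡ I (suc (double m)) ⊎ z ≡ O a
      only z d with neighbours-I (s≤s (s≤s z≤n)) a≤k (Down.edge d)
      ... | inj₁ refl = inj₂ refl
      ... | inj₂ (inj₁ refl) = ⊥-elim (Down-absurd refl refl (δ-I≤δ-I+2 a<k) d)
      ... | inj₂ (inj₂ refl) = inj₁ refl

  mirror-sum : ∀ {b s} → b + s ≡ k → b + (k + s) ≡ n
  mirror-sum {b} {s} b+s≡k = begin
    b + (k + s)  ≡⟨ cong (b +_) (+-comm k s) ⟩
    b + (s + k)  ≡⟨ +-assoc b s k ⟨
    b + s + k    ≡⟨ cong (_+ k) b+s≡k ⟩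
    k + k        ≡⟨ n≡k+k ⟨
    n            ∎
    where open ≡-Reasoning

  summand<n : ∀ {b s} → b + s ≡ k → b < n
  summand<n {b} b+s≡k = ≤k⇒<n (subst (b ≤_) b+s≡k (m≤m+n b _))

  mirror-≢ : ∀ {b s} → 0 < s → b + s ≡ k → b ≢ k + s
  mirror-≢ {b} 0<s b+s≡k = <⇒≢ (≤-<-trans (subst (b ≤_) b+s≡k (m≤m+n b _)) (m<m+n k 0<s))

  ρ-I-mirror : ∀ {b} → b + 2 ≡ k → ρ (I b) ≡ I (k + 2)
  ρ-I-mirror {b} b+2≡k = ρ-I (summand<n b+2≡k) (mirror-sum {b} b+2≡k)

  ρ-O-mirror : ∀ {b} → b + 1 ≡ k → ρ (O b) ≡ O (k + 1)
  ρ-O-mirror {b} b+1≡k = ρ-O (summand<n b+1≡k) (mirror-sum {b} b+1≡k)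

  I≢ρI : ∀ {b} → b + 2 ≡ k → I b ≢ ρ (I b)
  I≢ρI b+2≡k Ib≡ρIb =
    I-≢ (summand<n b+2≡k) k+2<n (mirror-≢ (s≤s z≤n) b+2≡k) (trans Ib≡ρIb (ρ-I-mirror b+2≡k))

  O≢ρO : ∀ {b} → b + 1 ≡ k → O b ≢ ρ (O b)
  O≢ρO b+1≡k Ob≡ρOb = O-≢ (summand<n b+1≡k) (≤-<-trans (+-monoʳ-≤ k (n≤1+n 1)) k+2<n)
    (mirror-≢ (s≤s z≤n) b+1≡k) (trans Ob≡ρOb (ρ-O-mirror b+1≡k))

  ρ-I-k : ρ (I k) ≡ I k
  ρ-I-k = ρ-I k<n (sym n≡k+k)

  I-k≢t : I k ≢ t
  I-k≢t = I-≢ k<n 0<n (λ k≡0 → <⇒≢ (≤-trans (s≤s z≤n) k≥3) (sym k≡0))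

  numGeodesics-I-k-even : ∀ m → double (suc m) ≡ k → NumGeodesics (I k) t 2
  numGeodesics-I-k-even m a≡k = descents⇒numGeodesics
    (descents-via-mirror I-k≢t ρ-I-k down₁ (I≢ρI b+2≡k) only (descents-I-even m b<k)) refl
    where
      b+2≡k : double m + 2 ≡ k
      b+2≡k = trans (+-comm (double m) 2) a≡k
      b<k : double m < k
      b<k = subst (double m <_) a≡k (<-trans (n<1+n _) (n<1+n _))
      δx : δ (I k) ≡ suc m
      δx = subst (λ v → δ (I v) ≡ suc m) a≡k (δ-I-double (suc m) (≤-reflexive a≡k))
      down₁ : Down (I k) (I (double m))
      down₁ = Down-intro (I-adj-I k<n (≤k⇒<n (<⇒≤ b<k)) b+2≡k) δx (δ-I-double m (<⇒≤ b<k))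
      δ-O-k : δ (O k) ≡ 2 + m
      δ-O-k = subst (λ v → δ (O v) ≡ 2 + m) a≡k (δ-O-double (suc m) (≤-reflexive a≡k))
      only : ∀ z → Down (I k) z → z ≡ I (double m) ⊎ z ≡ ρ (I (double m))
      only z d with neighbours-I 2≤k ≤-refl (Down.edge d)
      ... | inj₁ refl = ⊥-elim (Down-absurd δx δ-O-k (n≤1+n _) d)
      ... | inj₂ (inj₁ refl) = inj₂ (sym (ρ-I-mirror b+2≡k))
      ... | inj₂ (inj₂ refl) = inj₁ (cong I (sym (∸-≡ b+2≡k)))

  descents-O-k : ∀ m → suc (double (suc m)) ≡ k → let q = O (double (suc m)) ∷ evenPath (suc m) in
    Enumerates (Descent (O k)) ((O k ∷ q) ∷ (O k ∷ map ρ q) ∷ [])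
  descents-O-k m a≡k =
    descents-via-mirror (λ ()) (ρ-O k<n (sym n≡k+k)) down₁ (O≢ρO b+1≡k) only (descents-O-even (suc m) b<k)
    where
      b+1≡k : double (suc m) + 1 ≡ k
      b+1≡k = trans (+-comm _ 1) a≡k
      b<k : double (suc m) < k
      b<k = subst (double (suc m) <_) a≡k ≤-refl
      δx : δ (O k) ≡ 3 + m
      δx = subst (λ v → δ (O v) ≡ 3 + m) a≡k (δ-O-double+1 (suc m) (≤-reflexive a≡k))
      δ-I-k : δ (I k) ≡ 4 + m
      δ-I-k = subst (λ v → δ (I v) ≡ 4 + m) a≡k (δ-I-double+1 (suc m) (≤-reflexive a≡k))
      down₁ : Down (O k) (O (double (suc m)))
      down₁ = Down-intro (O-adj-O k<n (≤k⇒<n (<⇒≤ b<k)) b+1≡k) δx (δ-O-double (suc m) (<⇒≤ b<k))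
      only : ∀ z → Down (O k) z → z ≡ O (double (suc m)) ⊎ z ≡ ρ (O (double (suc m)))
      only z d with neighbours-O 1≤k ≤-refl (Down.edge d)
      ... | inj₁ refl = ⊥-elim (Down-absurd δx δ-I-k (n≤1+n _) d)
      ... | inj₂ (inj₁ refl) = inj₂ (sym (ρ-O-mirror b+1≡k))
      ... | inj₂ (inj₂ refl) = inj₁ (cong O (sym (∸-≡ b+1≡k)))

  length-oddPaths-mirrored : ∀ m (f : List (V n) → List (V n)) (p q : List (V n)) →
    length (map f (oddPaths m) ++ (map f (p ∷ q ∷ []) ++ map f (map (map ρ) (oddPaths m)))) ≡ 4 + double m
  length-oddPaths-mirrored m f p q = begin
    length (map f (oddPaths m) ++ (f p ∷ f q ∷ map f (map (map ρ) (oddPaths m))))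
      ≡⟨ length-++ (map f (oddPaths m)) ⟩
    length (map f (oddPaths m)) + (2 + length (map f (map (map ρ) (oddPaths m))))
      ≡⟨ cong₂ (λ u v → u + (2 + v)) (trans (length-map f (oddPaths m)) (length-oddPaths m))
           (trans (length-map f (map (map ρ) (oddPaths m))) (trans (length-map _ (oddPaths m)) (length-oddPaths m))) ⟩
    suc m + (2 + suc m)   ≡⟨ sum m ⟩
    4 + m * 2             ≡⟨ cong (4 +_) (double≡*2 m) ⟨
    4 + double m          ∎
    where
      open ≡-Reasoning
      sum : ∀ m → suc m + (2 + suc m) ≡ 4 + m * 2
      sum = solve-∀

  numGeodesics-I-k-odd : ∀ m → suc (double (suc m)) ≡ k → NumGeodesics (I k) t (suc k)
  numGeodesics-I-k-odd m a≡k = descents⇒numGeodesics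
    (descents-via₃ I-k≢t down₁ down₂ down₃ (λ ()) (I≢ρI b+2≡k) (λ ()) only
      (descents-I-odd m b<k) (descents-O-k m a≡k) (descents-ρ (descents-I-odd m b<k)))
    (trans (length-oddPaths-mirrored m _ _ _) (cong suc a≡k))
    where
      b = suc (double m)
      b+2≡k : b + 2 ≡ k
      b+2≡k = trans (+-comm b 2) a≡k
      b<k : b < k
      b<k = subst (b <_) a≡k (<-trans (n<1+n _) (n<1+n _))
      δx : δ (I k) ≡ 4 + m
      δx = subst (λ v → δ (I v) ≡ 4 + m) a≡k (δ-I-double+1 (suc m) (≤-reflexive a≡k))
      down₁ : Down (I k) (I b)
      down₁ = Down-intro (I-adj-I k<n (≤k⇒<n (<⇒≤ b<k)) b+2≡k) δx (δ-I-double+1 m (<⇒≤ b<k))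
      down₂ : Down (I k) (O k)
      down₂ = Down-intro refl δx (subst (λ v → δ (O v) ≡ 3 + m) a≡k (δ-O-double+1 (suc m) (≤-reflexive a≡k)))
      down₃ : Down (I k) (ρ (I b))
      down₃ = subst (λ w → Down w (ρ (I b))) ρ-I-k (Down-ρ down₁)
      only : ∀ z → Down (I k) z → z ≡ I b ⊎ z ≡ O k ⊎ z ≡ ρ (I b)
      only z d with neighbours-I 2≤k ≤-refl (Down.edge d)
      ... | inj₁ refl = inj₂ (inj₁ refl)
      ... | inj₂ (inj₁ refl) = inj₂ (inj₂ (sym (ρ-I-mirror b+2≡k)))
      ... | inj₂ (inj₂ refl) = inj₁ (cong I (sym (∸-≡ b+2≡k)))

  even⇒double : ∀ {r} → r % 2 ≡ 0 → ∃ λ m → r ≡ double m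
  even⇒double {r} r%2≡0 =
    r / 2 , trans (m≡m%n+[m/n]*n r 2) (trans (cong (_+ r / 2 * 2) r%2≡0) (sym (double≡*2 (r / 2))))

  odd⇒double+1 : ∀ {r} → r % 2 ≡ 1 → ∃ λ m → r ≡ suc (double m)
  odd⇒double+1 {r} r%2≡1 =
    r / 2 , trans (m≡m%n+[m/n]*n r 2) (trans (cong (_+ r / 2 * 2) r%2≡1) (cong suc (sym (double≡*2 (r / 2)))))

  numGeodesics-even-< : ∀ r → r ≢ 0 → r % 2 ≡ 0 → r < k → NumGeodesics (I r) t 1
  numGeodesics-even-< r r≢0 r%2≡0 r<k with even⇒double {r} r%2≡0
  ... | zero , r≡0 = ⊥-elim (r≢0 r≡0)
  ... | suc m , refl = descents⇒numGeodesics (descents-I-even (suc m) r<k) refl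

  numGeodesics-even-k : ∀ r → r ≢ 0 → r % 2 ≡ 0 → r ≡ k → NumGeodesics (I r) t 2
  numGeodesics-even-k r r≢0 r%2≡0 r≡k with even⇒double {r} r%2≡0
  ... | zero , r≡0 = ⊥-elim (r≢0 r≡0)
  ... | suc m , refl = subst (λ v → NumGeodesics (I v) t 2) (sym r≡k) (numGeodesics-I-k-even m r≡k)

  numGeodesics-odd-< : ∀ r → r % 2 ≡ 1 → r < k → NumGeodesics (I r) t ((r + 1) / 2)
  numGeodesics-odd-< r r%2≡1 r<k with odd⇒double+1 {r} r%2≡1
  ... | m , refl = subst (NumGeodesics (I r) t) (sym half)
                     (descents⇒numGeodesics (descents-I-odd m r<k) (length-oddPaths m))
    where
      half : (suc (double m) + 1) / 2 ≡ suc m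
      half = trans (cong (_/ 2) (trans (+-comm _ 1) (double≡*2 (suc m)))) (m*n/n≡m (suc m) 2)

  numGeodesics-odd-k : ∀ r → r % 2 ≡ 1 → r ≡ k → NumGeodesics (I r) t (r + 1)
  numGeodesics-odd-k r r%2≡1 r≡k with odd⇒double+1 {r} r%2≡1
  ... | zero , refl = ⊥-elim (<⇒≱ (s≤s (s≤s z≤n)) (≤-trans k≥3 (≤-reflexive (sym r≡k))))
  ... | suc m , refl = subst₂ (λ v c → NumGeodesics (I v) t c) (sym r≡k) (cong suc (trans (sym r≡k) (+-comm 1 _)))
                         (numGeodesics-I-k-odd m r≡k)

  rotate-to-origin : ∀ {c} (i j : Fin n) → toℕ j ≤ toℕ i →
    NumGeodesics (I (toℕ i ∸ toℕ j)) t c → NumGeodesics (inn i) (inn j) c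
  rotate-to-origin {c} i j j≤i counted = subst₂ (λ x y → NumGeodesics x y c) (φψ (inn i)) (φψ (inn j))
    (numGeodesics-φ (subst₂ (λ x y → NumGeodesics x y c) (sym ψi≡) (sym ψj≡) counted))
    where
      d = n ∸ toℕ j
      j+d≡n : toℕ j + d ≡ n
      j+d≡n = m+[n∸m]≡n (<⇒≤ (toℕ<n j))
      φψ : ∀ x → mapV (rotate (toℕ j)) (mapV (rotate d) x) ≡ x
      φψ = mapV-inverse (rotate-inverse d (toℕ j) (trans (+-comm d _) j+d≡n))
      open Automorphism (mapV (rotate (toℕ j))) (mapV (rotate d)) (mapV-inverse (rotate-inverse _ d j+d≡n)) φψ
             (mapV-adj (rotate-preservesShifts _)) (mapV-adj (rotate-preservesShifts d))
      ψi≡ : mapV (rotate d) (inn i) ≡ I (toℕ i ∸ toℕ j)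
      ψi≡ = cong inn (toℕ-injective (begin
        toℕ (rotate d i)                   ≡⟨ toℕ-rotate d i ⟩
        (toℕ i + d) % n                    ≡⟨ cong (λ v → (v + d) % n) (m∸n+n≡m j≤i) ⟨
        (toℕ i ∸ toℕ j + toℕ j + d) % n    ≡⟨ cong (_% n) (trans (+-assoc _ (toℕ j) d) (cong (toℕ i ∸ toℕ j +_) j+d≡n)) ⟩
        (toℕ i ∸ toℕ j + n) % n            ≡⟨ [m+n]%n≡m%n _ n ⟩
        (toℕ i ∸ toℕ j) % n                ≡⟨ toℕ-fromℕ< _ ⟨
        toℕ ((toℕ i ∸ toℕ j) mod n)        ∎))
        where open ≡-Reasoning
      ψj≡ : mapV (rotate d) (inn j) ≡ t
      ψj≡ = cong inn (toℕ-injective (trans (toℕ-rotate d j)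
              (trans (cong (_% n) j+d≡n) (trans (n%n≡0 n) (sym (toℕ-mod 0<n))))))

  numGeodesics-reduce : ∀ {c} (i j : Fin n) → NumGeodesics (I ∣ toℕ i - toℕ j ∣) t c → NumGeodesics (inn i) (inn j) c
  numGeodesics-reduce {c} i j counted with toℕ j ≤? toℕ i
  ... | yes j≤i = rotate-to-origin i j j≤i (subst (λ r → NumGeodesics (I r) t c) (m≤n⇒∣n-m∣≡n∸m j≤i) counted)
  ... | no j≰i = subst₂ (λ x y → NumGeodesics x y c) (opposite² (inn i)) (opposite² (inn j))
      (numGeodesics-φ (rotate-to-origin (opposite i) (opposite j) (subst (_ ≤_) (sym i′≡) (m≤m+n _ _)) counted′))
    where
      opposite² = mapV-inverse opposite-involutive
      open Automorphism (mapV opposite) (mapV opposite) opposite² opposite²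
             (mapV-adj opposite-preservesShifts) (mapV-adj opposite-preservesShifts)
      i≤j = <⇒≤ (≰⇒> j≰i)
      i′≡ : toℕ (opposite i) ≡ toℕ (opposite j) + (toℕ j ∸ toℕ i)
      i′≡ = +-cancelʳ-≡ (suc (toℕ i)) _ _ (begin
        toℕ (opposite i) + suc (toℕ i)                    ≡⟨ trans (opposite-+ i) (sym (opposite-+ j)) ⟩
        toℕ (opposite j) + suc (toℕ j)                    ≡⟨ cong (λ v → toℕ (opposite j) + suc v) (m∸n+n≡m i≤j) ⟨
        toℕ (opposite j) + suc (toℕ j ∸ toℕ i + toℕ i)    ≡⟨ cong (toℕ (opposite j) +_) (+-suc _ (toℕ i)) ⟨
        toℕ (opposite j) + (toℕ j ∸ toℕ i + suc (toℕ i))  ≡⟨ +-assoc (toℕ (opposite j)) _ _ ⟨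
        toℕ (opposite j) + (toℕ j ∸ toℕ i) + suc (toℕ i)  ∎)
        where open ≡-Reasoning
      counted′ : NumGeodesics (I (toℕ (opposite i) ∸ toℕ (opposite j))) t c
      counted′ = subst (λ r → NumGeodesics (I r) t c)
        (trans (m≤n⇒∣m-n∣≡n∸m i≤j) (sym (trans (cong (_∸ toℕ (opposite j)) i′≡) (m+n∸m≡n (toℕ (opposite j)) _))))
        counted

mainTheorem7 : (k : ℕ) → 3 ≤ k → (i j : Fin (2 * k)) → i ≢ j →
    ∣ toℕ i - toℕ j ∣ ≤ k →
    ((∣ toℕ i - toℕ j ∣ % 2 ≡ 0 → ∣ toℕ i - toℕ j ∣ < k → NumGeodesics (inn i) (inn j) 1)
    × (∣ toℕ i - toℕ j ∣ % 2 ≡ 0 → ∣ toℕ i - toℕ j ∣ ≡ k → NumGeodesics (inn i) (inn j) 2)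
    × (∣ toℕ i - toℕ j ∣ % 2 ≡ 1 → ∣ toℕ i - toℕ j ∣ < k → NumGeodesics (inn i) (inn j) ((∣ toℕ i - toℕ j ∣ + 1) / 2))
    × (∣ toℕ i - toℕ j ∣ % 2 ≡ 1 → ∣ toℕ i - toℕ j ∣ ≡ k → NumGeodesics (inn i) (inn j) (∣ toℕ i - toℕ j ∣ + 1)))
mainTheorem7 k k≥3 i j i≢j _ =
  (λ even r<k → numGeodesics-reduce i j (numGeodesics-even-< r r≢0 even r<k)) ,
  (λ even r≡k → numGeodesics-reduce i j (numGeodesics-even-k r r≢0 even r≡k)) ,
  (λ odd r<k → numGeodesics-reduce i j (numGeodesics-odd-< r odd r<k)) ,
  (λ odd r≡k → numGeodesics-reduce i j (numGeodesics-odd-k r odd r≡k))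
  where
    open GP2k k k≥3
    r = ∣ toℕ i - toℕ j ∣
    r≢0 : r ≢ 0
    r≢0 r≡0 = i≢j (toℕ-injective (∣m-n∣≡0⇒m≡n r≡0))
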